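{- Let $A$ be a finite abelian group of order $n$. Then the cycle graph $C_4$ is a sum graph over $(A,+)$ if and only if $5\mid n$.
   Context: Given a commutative magma $(M,\oplus)$ and a finite subset $V\subseteq M$, $\mathcal{G}_M(V)$ denotes the simple graph with vertex set $V$ in which two distinct vertices $v,w$ are adjacent if and only if $v\oplus w\in V$. A graph $G$ is a sum graph over $M$ if $G$ is isomorphic to $\mathcal{G}_M(V)$ for some $V\subseteq M$. -}

module Defs where

open import Level using (Level; _⊔_; 0ℓ)
open import Data.Nat using (ℕ; _+_; _%_)
open import Data.Fin using (Fin; toℕ)
open import Data.Product using (Σ; ∃; _×_; _,_)
open import Data.Sum using (_⊎_)
open import Relation.Nullary using (¬_)
open import Relation.Binary.PropositionalEquality using (_≡_)
import Relation.Binary.PropositionalEquality as ≡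
open import Function.Bundles using (Bijection; _⇔_)
open import Algebra.Bundles using (AbelianGroup)

record Graph (a : Level) (k : ℕ) : Set (Level.suc a) where
  field
    Adj : Fin k → Fin k → Set a

open Graph public

_≅_ : ∀ {a b k m} → Graph a k → Graph b m → Set (a ⊔ b)
_≅_ {k = k} {m = m} G H =
  Σ (Bijection (≡.setoid (Fin k)) (≡.setoid (Fin m))) λ σ →
    ∀ i j → (Adj G i j ⇔ Adj H (Bijection.to σ i) (Bijection.to σ j))

C₄ : Graph 0ℓ 4
C₄ = record { Adj = λ i j → ((toℕ i + 1) % 4 ≡ toℕ j) ⊎ ((toℕ j + 1) % 4 ≡ toℕ i) }

module _ {c ℓ : Level} (A : AbelianGroup c ℓ) where
  open AbelianGroup A

  record FinSubset (k : ℕ) : Set (c ⊔ ℓ) where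
    field
      elem     : Fin k → Carrier
      distinct : ∀ i j → elem i ≈ elem j → i ≡ j

  open FinSubset public

  _∈V_ : ∀ {k} → Carrier → FinSubset k → Set ℓ
  x ∈V V = ∃ λ l → x ≈ elem V l

  𝒢 : ∀ {k} → FinSubset k → Graph ℓ k
  𝒢 V = record { Adj = λ i j → ¬ (i ≡ j) × ((elem V i ∙ elem V j) ∈V V) }

  IsSumGraph : ∀ {a k} → Graph a k → Set (a ⊔ c ⊔ ℓ)
  IsSumGraph {k = k} G = Σ ℕ λ m → Σ (FinSubset m) λ V → G ≅ 𝒢 V

HasOrder : ∀ {c ℓ} → AbelianGroup c ℓ → ℕ → Set (c ⊔ ℓ)
HasOrder A n = Bijection (≡.setoid (Fin n)) (AbelianGroup.setoid A)

module Submission where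

-- Both sides are equivalent to A having an element of order 5. If the distinct vertices
-- a, b, c, d of a 4-cycle satisfy the sum-graph condition, no vertex is 0 (it would join two
-- opposite vertices), so every edge sum is one of the two other vertices; distinctness forces
-- the sums to run around the cycle in one direction, a + b = c, b + c = d, c + d = a, d + a = b,
-- whence 5b = 0 ≠ b. Conversely g, 2g, 4g, 3g is such a cycle when g has order 5. Finally A has
-- an element of order 5 iff 5 ∣ n, by counting orbits of a permutation of prime period p, whose
-- number of fixed points is ≡ N (mod p): translation by an element of order p has no fixed
-- points, and McKay's rotation of zero-sum 5-tuples fixes (0, …, 0), so if 5 ∣ n it fixes
-- another constant tuple (a, …, a), with 5a = 0 ≠ a.

open import Defs
open import Level using (Level)
import Data.Nat as ℕ
open import Data.Nat
  using (ℕ; zero; suc; _+_; _*_; _∸_; _≤_; _<_; _%_; _/_; s≤s; NonZero; >-nonZero; pred)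
open import Data.Nat.Properties
  using (_<?_; _≤?_; ≤-refl; ≤-trans; <⇒≤; ≰⇒>; ≤-antisym; <-cmp; +-comm; +-identityʳ; *-identityʳ;
         m≤m*n; m+[n∸m]≡n; m<n⇒0<n∸m; m∸n≤m; suc-pred; +-0-commutativeMonoid)
open import Data.Nat.DivMod using (_mod_; m≡m%n+[m/n]*n; m%n<n)
open import Data.Nat.Divisibility using (_∣_; _∣0; ∣-trans; m∣m*n; ∣m+n∣m⇒∣n; ∣m∣n⇒∣m+n; ∣1⇒≡1)
open import Data.Nat.Coprimality using (Coprime; coprime-Bézout; prime⇒coprime)
open import Data.Nat.GCD using (module Bézout)
open import Data.Nat.Primality using (Prime; prime?; prime⇒nonZero; ¬prime[1])
open import Data.Fin using (Fin; zero; suc; toℕ; punchIn; _≟_)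
open import Data.Fin.Patterns using (0F; 1F; 2F; 3F)
open import Data.Fin.Properties using (*↔×; punchInᵢ≢i; toℕ-fromℕ<; toℕ-injective; toℕ<n; all?; any?)
import Data.Fin.Permutation as Perm
open import Data.Product using (∃; _×_; _,_; proj₁; proj₂)
open import Data.Product.Properties using (,-injective)
open import Data.Product.Function.NonDependent.Propositional using (_×-↔_)
open import Data.Empty using (⊥-elim)
open import Data.Sum using (inj₁; inj₂)
open import Relation.Nullary using (¬_; Dec; yes; no)
open import Relation.Nullary.Decidable using (_×-dec_; _⊎-dec_; _→-dec_; ¬?; map′; from-yes)
open import Relation.Binary using (tri<; tri≈; tri>)
open import Relation.Binary.PropositionalEquality as ≡
  using (_≡_; _≢_; refl; sym; trans; cong; cong₂; subst; module ≡-Reasoning)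
open import Function using (_∘_)
open import Function.Bundles using (_⇔_; mk⇔; Equivalence; _↔_; Inverse; Bijection; Surjection)
open import Function.Properties.Inverse using (↔-refl; ↔-trans)
open import Function.Construct.Composition using (_⇔-∘_)
import Function.Construct.Identity as Identity
open import Algebra.Bundles using (AbelianGroup)
open import Algebra.Properties.CommutativeMonoid.Sum +-0-commutativeMonoid
  using (sum; sum-cong-≗; sum-replicate-zero; ∑-distrib-+; ∑-comm; sum-permute; sum-remove)

χ : ∀ {p} {P : Set p} → Dec P → ℕ
χ (yes _) = 1
χ (no _)  = 0

module _ {p} {P : Set p} where

  χ-yes : (P? : Dec P) → P → χ P? ≡ 1
  χ-yes (yes _) _  = refl
  χ-yes (no ¬p) p = ⊥-elim (¬p p)

  χ-no : (P? : Dec P) → ¬ P → χ P? ≡ 0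
  χ-no (yes p) ¬p = ⊥-elim (¬p p)
  χ-no (no _)  _  = refl

  χ+χ¬ : (P? : Dec P) → χ P? + χ (¬? P?) ≡ 1
  χ+χ¬ (yes _) = refl
  χ+χ¬ (no _)  = refl

  χ-cong : ∀ {q} {Q : Set q} (P? : Dec P) (Q? : Dec Q) → P ⇔ Q → χ P? ≡ χ Q?
  χ-cong P? (yes q) P⇔Q = χ-yes P? (Equivalence.from P⇔Q q)
  χ-cong P? (no ¬q) P⇔Q = χ-no P? (¬q ∘ Equivalence.to P⇔Q)

∑-const : ∀ n c → sum {n} (λ _ → c) ≡ n * c
∑-const zero    c = refl
∑-const (suc n) c = cong (c +_) (∑-const n c)

∑-zero : ∀ {n} (f : Fin n → ℕ) → (∀ i → f i ≡ 0) → sum f ≡ 0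
∑-zero {n} f f≗0 = trans (sum-cong-≗ f≗0) (sum-replicate-zero n)

∑χ-unique : ∀ {n p} {P : Fin n → Set p} (P? : ∀ i → Dec (P i)) (k : Fin n) →
            P k → (∀ i → P i → i ≡ k) → sum (λ i → χ (P? i)) ≡ 1
∑χ-unique {suc n} P? k Pk unique =
  trans (sum-remove {i = k} (λ i → χ (P? i)))
        (cong₂ _+_ (χ-yes (P? k) Pk)
                   (∑-zero _ (λ i → χ-no (P? (punchIn k i)) (punchInᵢ≢i k i ∘ unique _))))

minimiser : ∀ {m} .{{_ : NonZero m}} (t : Fin m → ℕ) → ∃ λ k → ∀ i → t k ≤ t i
minimiser {suc zero}    t = zero , λ { zero → ≤-refl }
minimiser {suc (suc m)} t with minimiser (t ∘ suc)
... | k , min with t zero ≤? t (suc k)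
...   | yes t₀≤ = zero , λ { zero → ≤-refl ; (suc i) → ≤-trans t₀≤ (min i) }
...   | no  t₀≰ = suc k , λ { zero → <⇒≤ (≰⇒> t₀≰) ; (suc i) → min i }

_⇔-dec_ : ∀ {p q} {P : Set p} {Q : Set q} → Dec P → Dec Q → Dec (P ⇔ Q)
P? ⇔-dec Q? = map′ (λ (f , g) → mk⇔ f g) (λ P⇔Q → Equivalence.to P⇔Q , Equivalence.from P⇔Q)
                   ((P? →-dec Q?) ×-dec (Q? →-dec P?))

5-prime : Prime 5
5-prime = from-yes (prime? 5)

record PeriodSet {ℓ} (P : ℕ → Set ℓ) : Set ℓ where
  field
    +-closed : ∀ {a b} → P a → P b → P (a + b)
    ∸-closed : ∀ {a b} → P a → P (a + b) → P b

module PeriodSetProperties {ℓ} {P : ℕ → Set ℓ} (periods : PeriodSet P) where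
  open PeriodSet periods

  0-closed : ∀ {a} → P a → P 0
  0-closed {a} Pa = ∸-closed Pa (subst P (sym (+-identityʳ a)) Pa)

  *-closed : ∀ {a} → P a → ∀ c → P (c * a)
  *-closed Pa zero    = 0-closed Pa
  *-closed Pa (suc c) = +-closed Pa (*-closed Pa c)

  coprime⇒1-closed : ∀ {m n} → Coprime m n → P m → P n → P 1
  coprime⇒1-closed {m} {n} coprime Pm Pn with coprime-Bézout coprime
  ... | Bézout.+- x y eq =
    ∸-closed (*-closed Pn y) (subst P (trans (sym eq) (+-comm 1 (y * n))) (*-closed Pm x))
  ... | Bézout.-+ x y eq =
    ∸-closed (*-closed Pm x) (subst P (trans (sym eq) (+-comm 1 (x * m))) (*-closed Pn y))

  prime⇒1-closed : ∀ {p d} → Prime p → P p → P d → 0 < d → d < p → P 1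
  prime⇒1-closed p-prime Pp Pd 0<d d<p =
    coprime⇒1-closed (prime⇒coprime p-prime {{>-nonZero 0<d}} d<p) Pp Pd

module Iteration {a} {X : Set a} (f : X → X) where

  iterate : ℕ → X → X
  iterate zero    x = x
  iterate (suc k) x = iterate k (f x)

  iterate-comm : ∀ k x → iterate k (f x) ≡ f (iterate k x)
  iterate-comm zero    x = refl
  iterate-comm (suc k) x = iterate-comm k (f x)

  iterate-+ : ∀ j k x → iterate (j + k) x ≡ iterate k (iterate j x)
  iterate-+ zero    k x = refl
  iterate-+ (suc j) k x = iterate-+ j k (f x)

  iterate-fixed : ∀ k {x} → f x ≡ x → iterate k x ≡ x
  iterate-fixed zero    fx≡x = refl
  iterate-fixed (suc k) fx≡x = trans (cong (iterate k) fx≡x) (iterate-fixed k fx≡x)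

  periods : ∀ x → PeriodSet (λ k → iterate k x ≡ x)
  periods x = record
    { +-closed = λ {a} {b} Pa Pb → trans (iterate-+ a b x) (trans (cong (iterate b) Pa) Pb)
    ; ∸-closed = λ {a} {b} Pa Pa+b →
        trans (cong (iterate b) (sym Pa)) (trans (sym (iterate-+ a b x)) Pa+b)
    }

iterate-conjugate : ∀ {a b} {X : Set a} {Y : Set b} (e : X ↔ Y) (f : Y → Y) k x →
                    Iteration.iterate (Inverse.from e ∘ f ∘ Inverse.to e) k x
                    ≡ Inverse.from e (Iteration.iterate f k (Inverse.to e x))
iterate-conjugate e f zero    x = sym (Inverse.strictlyInverseʳ e x)
iterate-conjugate e f (suc k) x =
  trans (iterate-conjugate e f k _)
        (cong (Inverse.from e ∘ Iteration.iterate f k) (Inverse.strictlyInverseˡ e (f (Inverse.to e x))))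

#fixedPoints : ∀ {N} → (Fin N → Fin N) → ℕ
#fixedPoints σ = sum (λ x → χ (σ x ≟ x))

module PrimeOrbits {N} (σ : Fin N → Fin N) {p} (p-prime : Prime p)
                   (periodic : ∀ x → Iteration.iterate σ p x ≡ x) where
  open Iteration σ

  private instance
    p≢0 : NonZero p
    p≢0 = prime⇒nonZero p-prime

  Fixed : Fin N → Set
  Fixed x = σ x ≡ x

  orbit : Fin N → Fin p → Fin N
  orbit x i = iterate (toℕ i) x

  multiple-period : ∀ c x → iterate (c * p) x ≡ x
  multiple-period c x = PeriodSetProperties.*-closed (periods x) (periodic x) c

  orbit-mod : ∀ k x → iterate k x ≡ orbit x (k mod p)
  orbit-mod k x = begin
    iterate k x                               ≡⟨ cong (λ m → iterate m x) (m≡m%n+[m/n]*n k p) ⟩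
    iterate (k % p + (k / p) * p) x           ≡⟨ iterate-+ (k % p) _ x ⟩
    iterate ((k / p) * p) (iterate (k % p) x) ≡⟨ multiple-period (k / p) _ ⟩
    iterate (k % p) x                         ≡⟨ cong (λ m → iterate m x) (toℕ-fromℕ< (m%n<n k p)) ⟨
    orbit x (k mod p)                         ∎
    where open ≡-Reasoning

  iterate-return : ∀ a x → ∃ λ m → iterate m (iterate a x) ≡ x
  iterate-return a x = a * p ∸ a , (begin
    iterate (a * p ∸ a) (iterate a x) ≡⟨ iterate-+ a _ x ⟨
    iterate (a + (a * p ∸ a)) x       ≡⟨ cong (λ m → iterate m x) (m+[n∸m]≡n (m≤m*n a p)) ⟩
    iterate (a * p) x                 ≡⟨ multiple-period a x ⟩
    x                                 ∎)
    where open ≡-Reasoning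

  fixed-backward : ∀ a x → Fixed (iterate a x) → Fixed x
  fixed-backward a x fixed with iterate-return a x
  ... | m , return = subst Fixed (trans (sym (iterate-fixed m fixed)) return) fixed

  fixed-of-period : ∀ {d y} → iterate d y ≡ y → 0 < d → d < p → Fixed y
  fixed-of-period {y = y} period 0<d d<p =
    PeriodSetProperties.prime⇒1-closed (periods y) p-prime (periodic y) period 0<d d<p

  orbit-distinct : ∀ {x} → ¬ Fixed x → ∀ {a b} → a < b → b < p → iterate a x ≢ iterate b x
  orbit-distinct {x} unfixed {a} {b} a<b b<p eq = unfixed (fixed-backward a x
    (fixed-of-period period (m<n⇒0<n∸m a<b) (≤-trans (s≤s (m∸n≤m b a)) b<p)))
    where
    period : iterate (b ∸ a) (iterate a x) ≡ iterate a x
    period = trans (sym (iterate-+ a (b ∸ a) x))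
                   (trans (cong (λ m → iterate m x) (m+[n∸m]≡n (<⇒≤ a<b))) (sym eq))

  orbit-injective : ∀ {x} → ¬ Fixed x → ∀ i j → orbit x i ≡ orbit x j → i ≡ j
  orbit-injective unfixed i j eq with <-cmp (toℕ i) (toℕ j)
  ... | tri< i<j _ _ = ⊥-elim (orbit-distinct unfixed i<j (toℕ<n j) eq)
  ... | tri≈ _ i≡j _ = toℕ-injective i≡j
  ... | tri> _ _ j<i = ⊥-elim (orbit-distinct unfixed j<i (toℕ<n i) (sym eq))

  orbit-orbit : ∀ x k i → orbit (orbit x k) i ≡ orbit x ((toℕ k + toℕ i) mod p)
  orbit-orbit x k i = trans (sym (iterate-+ (toℕ k) (toℕ i) x)) (orbit-mod _ x)

  orbit-back : ∀ x k i → ∃ λ j → orbit (orbit x k) j ≡ orbit x i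
  orbit-back x k i with iterate-return (toℕ k) x
  ... | m , return = (m + toℕ i) mod p , (begin
    orbit (orbit x k) ((m + toℕ i) mod p)   ≡⟨ orbit-mod (m + toℕ i) (orbit x k) ⟨
    iterate (m + toℕ i) (orbit x k)         ≡⟨ iterate-+ m (toℕ i) (orbit x k) ⟩
    iterate (toℕ i) (iterate m (orbit x k)) ≡⟨ cong (iterate (toℕ i)) return ⟩
    orbit x i                               ∎)
    where open ≡-Reasoning

  -- Every orbit of size p has exactly one leader, so N = #fixed + p · #leaders.
  Leader : Fin N → Set
  Leader y = ¬ Fixed y × (∀ i → toℕ y ≤ toℕ (orbit y i))

  leader? : ∀ y → Dec (Leader y)
  leader? y = ¬? (σ y ≟ y) ×-dec all? (λ i → toℕ y ≤? toℕ (orbit y i))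

  #leaders : ℕ
  #leaders = sum (λ y → χ (leader? y))

  MinimalOnOrbit : Fin N → Fin p → Set
  MinimalOnOrbit x k = ∀ i → toℕ (orbit x k) ≤ toℕ (orbit x i)

  leader⇔minimal : ∀ {x} → ¬ Fixed x → ∀ k → Leader (orbit x k) ⇔ MinimalOnOrbit x k
  leader⇔minimal {x} unfixed k = mk⇔ to from
    where
    to : Leader (orbit x k) → MinimalOnOrbit x k
    to (_ , minimal) i with orbit-back x k i
    ... | j , eq = subst (λ z → toℕ (orbit x k) ≤ toℕ z) eq (minimal j)
    from : MinimalOnOrbit x k → Leader (orbit x k)
    from minimal = unfixed ∘ fixed-backward (toℕ k) x
                 , λ j → subst (λ z → toℕ (orbit x k) ≤ toℕ z) (sym (orbit-orbit x k j))
                               (minimal ((toℕ k + toℕ j) mod p))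

  leaders-along-orbit : ∀ x → sum (λ i → χ (leader? (orbit x i))) ≡ χ (¬? (σ x ≟ x))
  leaders-along-orbit x with σ x ≟ x
  ... | yes fixed = ∑-zero _ (λ i → χ-no (leader? (orbit x i))
    (λ (unfixed , _) → unfixed (subst Fixed (sym (iterate-fixed (toℕ i) fixed)) fixed)))
  ... | no unfixed with minimiser (λ i → toℕ (orbit x i))
  ...   | k , minimal =
    trans (sum-cong-≗ (λ i → χ-cong (leader? (orbit x i)) (minimal? i) (leader⇔minimal unfixed i)))
          (∑χ-unique minimal? k minimal unique)
    where
    minimal? : ∀ i → Dec (MinimalOnOrbit x i)
    minimal? i = all? (λ j → toℕ (orbit x i) ≤? toℕ (orbit x j))
    unique : ∀ i → MinimalOnOrbit x i → i ≡ k
    unique i minimal-i = orbit-injective unfixed i k (toℕ-injective (≤-antisym (minimal-i k) (minimal i)))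

  sum-∘σ : ∀ (f : Fin N → ℕ) → sum (f ∘ σ) ≡ sum f
  sum-∘σ f = sym (sum-permute f (Perm.permutation σ σ⁻¹ σ∘σ⁻¹ σ⁻¹∘σ))
    where
    σ⁻¹ : Fin N → Fin N
    σ⁻¹ = iterate (pred p)
    σ⁻¹∘σ : ∀ x → σ⁻¹ (σ x) ≡ x
    σ⁻¹∘σ x = trans (cong (λ m → iterate m x) (suc-pred p)) (periodic x)
    σ∘σ⁻¹ : ∀ x → σ (σ⁻¹ x) ≡ x
    σ∘σ⁻¹ x = trans (sym (iterate-comm (pred p) x)) (σ⁻¹∘σ x)

  sum-∘iterate : ∀ (f : Fin N → ℕ) k → sum (f ∘ iterate k) ≡ sum f
  sum-∘iterate f zero    = refl
  sum-∘iterate f (suc k) = trans (sum-∘σ (f ∘ iterate k)) (sum-∘iterate f k)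

  card≡#fixedPoints+p*#leaders : N ≡ #fixedPoints σ + p * #leaders
  card≡#fixedPoints+p*#leaders = begin
    N                                        ≡⟨ trans (∑-const N 1) (*-identityʳ N) ⟨
    sum {N} (λ _ → 1)                        ≡⟨ sum-cong-≗ (λ x → χ+χ¬ (σ x ≟ x)) ⟨
    sum (λ x → χ (σ x ≟ x) + unfixed x)      ≡⟨ ∑-distrib-+ (λ x → χ (σ x ≟ x)) unfixed ⟩
    F + sum unfixed                          ≡⟨ cong (F +_) (sum-cong-≗ leaders-along-orbit) ⟨
    F + sum (λ x → sum (λ i → leader x i))   ≡⟨ cong (F +_) (∑-comm leader) ⟩
    F + sum {p} (λ i → sum (λ x → leader x i)) ≡⟨ cong (F +_) (sum-cong-≗ {p} λ i →
                                                   sum-∘iterate (λ y → χ (leader? y)) (toℕ i)) ⟩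
    F + sum {p} (λ _ → #leaders)             ≡⟨ cong (F +_) (∑-const p #leaders) ⟩
    F + p * #leaders                         ∎
    where
    open ≡-Reasoning
    F : ℕ
    F = #fixedPoints σ
    unfixed : Fin N → ℕ
    unfixed x = χ (¬? (σ x ≟ x))
    leader : Fin N → Fin p → ℕ
    leader x i = χ (leader? (orbit x i))

  p∣N⇔p∣#fixedPoints : p ∣ N ⇔ p ∣ #fixedPoints σ
  p∣N⇔p∣#fixedPoints = mk⇔
    (λ p∣N → ∣m+n∣m⇒∣n (subst (p ∣_) (trans card≡#fixedPoints+p*#leaders (+-comm (#fixedPoints σ) _))
                               p∣N)
                        (m∣m*n #leaders))
    (λ p∣F → subst (p ∣_) (sym card≡#fixedPoints+p*#leaders) (∣m∣n⇒∣m+n p∣F (m∣m*n #leaders)))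

  another-fixed-point : p ∣ N → ∀ {x₀} → Fixed x₀ → ∃ λ x → Fixed x × x ≢ x₀
  another-fixed-point p∣N {x₀} fixed₀ with any? (λ x → (σ x ≟ x) ×-dec ¬? (x ≟ x₀))
  ... | yes found = found
  ... | no none = ⊥-elim (¬prime[1] (subst Prime (∣1⇒≡1 p∣1) p-prime))
    where
    only-x₀ : ∀ x → Fixed x → x ≡ x₀
    only-x₀ x fixed with x ≟ x₀
    ... | yes x≡x₀ = x≡x₀
    ... | no  x≢x₀ = ⊥-elim (none (x , fixed , x≢x₀))
    p∣1 : p ∣ 1
    p∣1 = subst (p ∣_) (∑χ-unique (λ x → σ x ≟ x) x₀ fixed₀ only-x₀)
                (Equivalence.to p∣N⇔p∣#fixedPoints p∣N)

module ElementOrders {c ℓ} (A : AbelianGroup c ℓ) where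
  open AbelianGroup A renaming (refl to ≈-refl; sym to ≈-sym; trans to ≈-trans)
  open import Algebra.Properties.Monoid.Mult monoid using (×-homo-+; ×-congˡ) renaming (_×_ to _·_)
  open import Algebra.Properties.Group group using (∙-cancelˡ; inverseʳ-unique)
  open import Algebra.Solver.CommutativeMonoid commutativeMonoid using (solve; _⊕_; _⊜_)
  open import Relation.Binary.Reasoning.Setoid setoid

  -- For a prime p this says that g has order exactly p.
  _OfOrder_ : Carrier → ℕ → Set ℓ
  g OfOrder p = ¬ g ≈ ε × p · g ≈ ε

  ∙-identity⇒ε : ∀ {x y} → x ∙ y ≈ x → y ≈ ε
  ∙-identity⇒ε {x} {y} eq = ∙-cancelˡ x y ε (≈-trans eq (≈-sym (identityʳ x)))

  multiples-periods : ∀ g → PeriodSet (λ k → k · g ≈ ε)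
  multiples-periods g = record
    { +-closed = λ {a} {b} Pa Pb → ≈-trans (×-homo-+ g a b) (≈-trans (∙-cong Pa Pb) (identityˡ ε))
    ; ∸-closed = λ {a} {b} Pa Pa+b → begin
        b · g             ≈⟨ identityˡ _ ⟨
        ε ∙ b · g         ≈⟨ ∙-congʳ Pa ⟨
        a · g ∙ b · g     ≈⟨ ×-homo-+ g a b ⟨
        (a + b) · g       ≈⟨ Pa+b ⟩
        ε                 ∎
    }

  module _ {p g} (p-prime : Prime p) (order : g OfOrder p) where
    open PeriodSetProperties (multiples-periods g) using (*-closed; prime⇒1-closed)

    private instance
      p≢0 : NonZero p
      p≢0 = prime⇒nonZero p-prime

    ·-mod : ∀ m → m · g ≈ (m % p) · g
    ·-mod m = begin
      m · g                            ≈⟨ ×-congˡ (m≡m%n+[m/n]*n m p) ⟩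
      (m % p + (m / p) * p) · g        ≈⟨ ×-homo-+ g (m % p) _ ⟩
      (m % p) · g ∙ ((m / p) * p) · g  ≈⟨ ∙-congˡ (*-closed (proj₂ order) (m / p)) ⟩
      (m % p) · g ∙ ε                  ≈⟨ identityʳ _ ⟩
      (m % p) · g                      ∎

    ·≉ε : ∀ {d} → 0 < d → d < p → ¬ d · g ≈ ε
    ·≉ε 0<d d<p d·g≈ε = proj₁ order (≈-trans (≈-sym (identityʳ g))
      (prime⇒1-closed p-prime (proj₂ order) d·g≈ε 0<d d<p))

    ·-distinct : ∀ {i j} → i < j → j < p → ¬ i · g ≈ j · g
    ·-distinct {i} {j} i<j j<p i·g≈j·g =
      ·≉ε (m<n⇒0<n∸m i<j) (≤-trans (s≤s (m∸n≤m j i)) j<p) (∙-identity⇒ε (begin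
      i · g ∙ (j ∸ i) · g  ≈⟨ ×-homo-+ g i (j ∸ i) ⟨
      (i + (j ∸ i)) · g    ≈⟨ ×-congˡ (m+[n∸m]≡n (<⇒≤ i<j)) ⟩
      j · g                ≈⟨ i·g≈j·g ⟨
      i · g                ∎))

    ·-injective : ∀ {i j} → i < p → j < p → i · g ≈ j · g → i ≡ j
    ·-injective {i} {j} i<p j<p eq with <-cmp i j
    ... | tri< i<j _ _ = ⊥-elim (·-distinct i<j j<p eq)
    ... | tri≈ _ i≡j _ = i≡j
    ... | tri> _ _ j<i = ⊥-elim (·-distinct j<i i<p (≈-sym eq))

  module _ {n} (β : HasOrder A n) where
    open Bijection β using (to; to⁻; injective)

    to∘to⁻ : ∀ x → to (to⁻ x) ≈ x
    to∘to⁻ = Surjection.to∘to⁻ (Bijection.surjection β)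

    order∣card : ∀ {p g} → Prime p → g OfOrder p → p ∣ n
    order∣card {p} {g} p-prime order =
      Equivalence.from (PrimeOrbits.p∣N⇔p∣#fixedPoints τ p-prime periodic)
                       (subst (p ∣_) (sym no-fixed-points) (p ∣0))
      where
      τ : Fin n → Fin n
      τ i = to⁻ (to i ∙ g)
      open Iteration τ
      to-iterate : ∀ k i → to (iterate k i) ≈ to i ∙ k · g
      to-iterate zero    i = ≈-sym (identityʳ _)
      to-iterate (suc k) i = ≈-trans (to-iterate k (τ i)) (≈-trans (∙-congʳ (to∘to⁻ _)) (assoc _ _ _))
      periodic : ∀ i → iterate p i ≡ i
      periodic i = injective (≈-trans (to-iterate p i) (≈-trans (∙-congˡ (proj₂ order)) (identityʳ _)))
      no-fixed-points : #fixedPoints τ ≡ 0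
      no-fixed-points = ∑-zero _ (λ i → χ-no (τ i ≟ i) (λ τi≡i →
        proj₁ order (∙-identity⇒ε (≈-trans (≈-sym (to∘to⁻ _)) (reflexive (cong to τi≡i))))))

    -- McKay's proof of Cauchy's theorem: a quadruple stands for the zero-sum 5-tuple it
    -- extends to, and rotating such tuples is a permutation of period 5.
    Quadruple : Set
    Quadruple = Fin n × Fin n × Fin n × Fin n

    quadruples : Fin (n * (n * (n * n))) ↔ Quadruple
    quadruples = ↔-trans *↔× (↔-refl ×-↔ ↔-trans *↔× (↔-refl ×-↔ *↔×))

    ZeroSum : Fin n → Fin n → Fin n → Fin n → Fin n → Set ℓ
    ZeroSum a b c d e = to a ∙ (to b ∙ (to c ∙ (to d ∙ to e))) ≈ ε

    zeroSum-rotate : ∀ {a b c d e} → ZeroSum a b c d e → ZeroSum b c d e a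
    zeroSum-rotate {a} {b} {c} {d} {e} = ≈-trans
      (solve 5 (λ a b c d e → b ⊕ (c ⊕ (d ⊕ (e ⊕ a))) ⊜ a ⊕ (b ⊕ (c ⊕ (d ⊕ e)))) ≈-refl
             (to a) (to b) (to c) (to d) (to e))

    regroup : ∀ a b c d e →
              to a ∙ (to b ∙ (to c ∙ (to d ∙ to e))) ≈ (to a ∙ (to b ∙ (to c ∙ to d))) ∙ to e
    regroup a b c d e =
      solve 5 (λ a b c d e → a ⊕ (b ⊕ (c ⊕ (d ⊕ e))) ⊜ (a ⊕ (b ⊕ (c ⊕ d))) ⊕ e) ≈-refl
              (to a) (to b) (to c) (to d) (to e)

    complete : Fin n → Fin n → Fin n → Fin n → Fin n
    complete a b c d = to⁻ ((to a ∙ (to b ∙ (to c ∙ to d))) ⁻¹)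

    completes : ∀ a b c d → ZeroSum a b c d (complete a b c d)
    completes a b c d = ≈-trans (regroup a b c d _) (≈-trans (∙-congˡ (to∘to⁻ _)) (inverseʳ _))

    complete-unique : ∀ {a b c d e} → ZeroSum a b c d e → complete a b c d ≡ e
    complete-unique {a} {b} {c} {d} {e} zero-sum = injective (≈-trans (to∘to⁻ _)
      (≈-sym (inverseʳ-unique _ (to e) (≈-trans (≈-sym (regroup a b c d e)) zero-sum))))

    rotate : Quadruple → Quadruple
    rotate (a , b , c , d) = b , c , d , complete a b c d

    rotate-shifts : ∀ {a b c d e} → ZeroSum a b c d e → rotate (b , c , d , e) ≡ (c , d , e , a)
    rotate-shifts zero-sum = cong (λ x → _ , _ , _ , x) (complete-unique (zeroSum-rotate zero-sum))

    rotate-periodic : ∀ q → Iteration.iterate rotate 5 q ≡ q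
    rotate-periodic (a , b , c , d) =
      trans (cong (iterate 3) (rotate-shifts s₀)) (trans (cong (iterate 2) (rotate-shifts s₁))
        (trans (cong (iterate 1) (rotate-shifts s₂)) (rotate-shifts s₃)))
      where
      open Iteration rotate
      s₀ : ZeroSum a b c d (complete a b c d)
      s₀ = completes a b c d
      s₁ : ZeroSum b c d (complete a b c d) a
      s₁ = zeroSum-rotate s₀
      s₂ : ZeroSum c d (complete a b c d) a b
      s₂ = zeroSum-rotate s₁
      s₃ : ZeroSum d (complete a b c d) a b c
      s₃ = zeroSum-rotate s₂

    rotate-fixed : ∀ {q} → rotate q ≡ q → ∃ λ a → q ≡ (a , a , a , a) × 5 · to a ≈ ε
    rotate-fixed {a , b , c , d} eq with ,-injective eq
    ... | refl , eq₁ with ,-injective eq₁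
    ...   | refl , eq₂ with ,-injective eq₂
    ...     | refl , complete≡a =
      a , refl , ≈-trans (∙-congˡ (∙-congˡ (∙-congˡ (∙-congˡ (identityʳ (to a))))))
                         (subst (ZeroSum a a a a) complete≡a (completes a a a a))

    zero₄ : Quadruple
    zero₄ = to⁻ ε , to⁻ ε , to⁻ ε , to⁻ ε

    rotate-zero₄ : rotate zero₄ ≡ zero₄
    rotate-zero₄ = rotate-shifts (begin
      to (to⁻ ε) ∙ (to (to⁻ ε) ∙ (to (to⁻ ε) ∙ (to (to⁻ ε) ∙ to (to⁻ ε))))
        ≈⟨ ∙-cong (to∘to⁻ ε) (∙-cong (to∘to⁻ ε)
             (∙-cong (to∘to⁻ ε) (∙-cong (to∘to⁻ ε) (to∘to⁻ ε)))) ⟩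
      ε ∙ (ε ∙ (ε ∙ (ε ∙ ε)))
        ≈⟨ ≈-trans (identityˡ _) (≈-trans (identityˡ _) (≈-trans (identityˡ _) (identityˡ _))) ⟩
      ε ∎)

    open Inverse quadruples using (strictlyInverseˡ; strictlyInverseʳ)
      renaming (from to encode; to to decode)

    ρ : Fin (n * (n * (n * n))) → Fin (n * (n * (n * n)))
    ρ = encode ∘ rotate ∘ decode

    ρ-periodic : ∀ x → Iteration.iterate ρ 5 x ≡ x
    ρ-periodic x = trans (iterate-conjugate quadruples rotate 5 x)
                         (trans (cong encode (rotate-periodic (decode x))) (strictlyInverseʳ x))

    ρ-fixed⇒rotate-fixed : ∀ {x} → ρ x ≡ x → rotate (decode x) ≡ decode x
    ρ-fixed⇒rotate-fixed eq = trans (sym (strictlyInverseˡ _)) (cong decode eq)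

    rotate-fixed⇒ρ-fixed : ∀ {q} → rotate q ≡ q → ρ (encode q) ≡ encode q
    rotate-fixed⇒ρ-fixed {q} eq = cong encode (trans (cong rotate (strictlyInverseˡ q)) eq)

    cauchy₅ : 5 ∣ n → ∃ λ g → g OfOrder 5
    cauchy₅ 5∣n = to a , to-a≉ε , proj₂ (proj₂ constant)
      where
      another : ∃ λ x → ρ x ≡ x × x ≢ encode zero₄
      another = PrimeOrbits.another-fixed-point ρ 5-prime ρ-periodic (∣-trans 5∣n (m∣m*n _))
                                                (rotate-fixed⇒ρ-fixed rotate-zero₄)
      x : Fin (n * (n * (n * n)))
      x = proj₁ another
      constant : ∃ λ a → decode x ≡ (a , a , a , a) × 5 · to a ≈ ε
      constant = rotate-fixed (ρ-fixed⇒rotate-fixed (proj₁ (proj₂ another)))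
      a : Fin n
      a = proj₁ constant
      to-a≉ε : ¬ to a ≈ ε
      to-a≉ε to-a≈ε = proj₂ (proj₂ another) (trans (sym (strictlyInverseʳ x))
        (cong encode (trans (proj₁ (proj₂ constant)) (cong (λ y → y , y , y , y) a≡0̂))))
        where
        a≡0̂ : a ≡ to⁻ ε
        a≡0̂ = injective (≈-trans to-a≈ε (≈-sym (to∘to⁻ ε)))

-- For g of order 5, vertex k of C₄ will be 2ᵏ·g: consecutive vertices then sum to
-- 3·2ᵏ·g = 2ᵏ⁺³·g, and opposite ones to 5·2ᵏ·g = 0.
exponent : Fin 4 → ℕ
exponent 0F = 1
exponent 1F = 2
exponent 2F = 4
exponent 3F = 3

exponent-injective : ∀ i j → exponent i ≡ exponent j → i ≡ j
exponent-injective = from-yes (all? λ i → all? λ j → (exponent i ℕ.≟ exponent j) →-dec (i ≟ j))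

exponent-bounds : ∀ k → 0 < exponent k × exponent k < 5
exponent-bounds = from-yes (all? λ k → (0 <? exponent k) ×-dec (exponent k <? 5))

C₄-adjacency-by-exponents : ∀ i j →
  Adj C₄ i j ⇔ (i ≢ j × ∃ λ k → (exponent i + exponent j) % 5 ≡ exponent k)
C₄-adjacency-by-exponents = from-yes (all? λ i → all? λ j →
  (((toℕ i + 1) % 4 ℕ.≟ toℕ j) ⊎-dec ((toℕ j + 1) % 4 ℕ.≟ toℕ i))
  ⇔-dec (¬? (i ≟ j) ×-dec any? (λ k → (exponent i + exponent j) % 5 ℕ.≟ exponent k)))

module C₄SumGraphs {c ℓ} (A : AbelianGroup c ℓ) where
  open AbelianGroup A renaming (refl to ≈-refl; sym to ≈-sym; trans to ≈-trans)
  open ElementOrders A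
  open import Algebra.Properties.Monoid.Mult monoid using (×-homo-+; ×-congˡ) renaming (_×_ to _·_)
  open import Algebra.Properties.Group group using (∙-cancelʳ)
  open import Algebra.Solver.CommutativeMonoid commutativeMonoid using (solve; _⊕_; _⊜_; id)
  open import Relation.Binary.Reasoning.Setoid setoid

  module _ {g} (order : g OfOrder 5) where

    cycle : FinSubset A 4
    cycle = record
      { elem     = λ k → exponent k · g
      ; distinct = λ i j eq → exponent-injective i j
          (·-injective 5-prime order (proj₂ (exponent-bounds i)) (proj₂ (exponent-bounds j)) eq)
      }

    cycle-sum : ∀ i j → elem cycle i ∙ elem cycle j ≈ ((exponent i + exponent j) % 5) · g
    cycle-sum i j = ≈-trans (≈-sym (×-homo-+ g (exponent i) (exponent j)))
                            (·-mod 5-prime order (exponent i + exponent j))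

    cycle-adjacency : ∀ i j → Adj C₄ i j ⇔ Adj (𝒢 A cycle) i j
    cycle-adjacency i j = mk⇔ to from ⇔-∘ C₄-adjacency-by-exponents i j
      where
      r : ℕ
      r = (exponent i + exponent j) % 5
      to : (i ≢ j × ∃ λ k → r ≡ exponent k) → Adj (𝒢 A cycle) i j
      to (i≢j , k , r≡) = i≢j , k , ≈-trans (cycle-sum i j) (×-congˡ r≡)
      from : Adj (𝒢 A cycle) i j → (i ≢ j × ∃ λ k → r ≡ exponent k)
      from (i≢j , k , sum≈) = i≢j , k , ·-injective 5-prime order (m%n<n (exponent i + exponent j) 5)
                                          (proj₂ (exponent-bounds k)) (≈-trans (≈-sym (cycle-sum i j)) sum≈)

    order5⇒sumGraph : IsSumGraph A C₄
    order5⇒sumGraph = 4 , cycle , Identity.bijection (≡.setoid (Fin 4)) , cycle-adjacency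

  shared-summand : ∀ {x y z s} → x ∙ y ≈ s → z ∙ x ≈ s → z ≈ y
  shared-summand {x} {y} {z} x∙y≈s z∙x≈s =
    ∙-cancelʳ x z y (≈-trans z∙x≈s (≈-trans (≈-sym x∙y≈s) (comm x y)))

  -- With c = a + b and d = a + 2b, the last two equations say a + 3b = 0 and 2a + b = 0,
  -- and 5b = 2(a + 3b) - (2a + b).
  fibonacci-cycle : ∀ {a b c d} → a ∙ b ≈ c → b ∙ c ≈ d → c ∙ d ≈ a → d ∙ a ≈ b → 5 · b ≈ ε
  fibonacci-cycle {a} {b} {c} {d} a∙b≈c b∙c≈d c∙d≈a d∙a≈b = begin
    5 · b
      ≈⟨ identityˡ _ ⟨
    ε ∙ 5 · b
      ≈⟨ ∙-congʳ 2a+b≈ε ⟨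
    (a ∙ (a ∙ b)) ∙ 5 · b
      ≈⟨ solve 2 (λ a b → (a ⊕ (a ⊕ b)) ⊕ (b ⊕ (b ⊕ (b ⊕ (b ⊕ (b ⊕ id)))))
                         ⊜ (a ⊕ (b ⊕ (b ⊕ b))) ⊕ (a ⊕ (b ⊕ (b ⊕ b)))) ≈-refl a b ⟩
    (a ∙ (b ∙ (b ∙ b))) ∙ (a ∙ (b ∙ (b ∙ b)))
      ≈⟨ ∙-cong a+3b≈ε a+3b≈ε ⟩
    ε ∙ ε
      ≈⟨ identityˡ ε ⟩
    ε ∎
    where
    d≈b+[a+b] : d ≈ b ∙ (a ∙ b)
    d≈b+[a+b] = ≈-trans (≈-sym b∙c≈d) (∙-congˡ (≈-sym a∙b≈c))
    a+3b≈ε : a ∙ (b ∙ (b ∙ b)) ≈ ε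
    a+3b≈ε = ∙-identity⇒ε (begin
      a ∙ (a ∙ (b ∙ (b ∙ b)))
        ≈⟨ solve 2 (λ a b → a ⊕ (a ⊕ (b ⊕ (b ⊕ b))) ⊜ (a ⊕ b) ⊕ (b ⊕ (a ⊕ b))) ≈-refl a b ⟩
      (a ∙ b) ∙ (b ∙ (a ∙ b))
        ≈⟨ ∙-cong a∙b≈c (≈-sym d≈b+[a+b]) ⟩
      c ∙ d
        ≈⟨ c∙d≈a ⟩
      a ∎)
    2a+b≈ε : a ∙ (a ∙ b) ≈ ε
    2a+b≈ε = ∙-identity⇒ε (begin
      b ∙ (a ∙ (a ∙ b))
        ≈⟨ solve 2 (λ a b → b ⊕ (a ⊕ (a ⊕ b)) ⊜ (b ⊕ (a ⊕ b)) ⊕ a) ≈-refl a b ⟩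
      (b ∙ (a ∙ b)) ∙ a
        ≈⟨ ∙-congʳ (≈-sym d≈b+[a+b]) ⟩
      d ∙ a
        ≈⟨ d∙a≈b ⟩
      b ∎)

  module _ {m} (V : FinSubset A m) (iso : C₄ ≅ 𝒢 A V) where
    open Bijection (proj₁ iso) using ()
      renaming (to to place; injective to place-injective; surjective to place-surjective)

    vertex : Fin 4 → Carrier
    vertex i = elem V (place i)

    OnCycle : Carrier → Set ℓ
    OnCycle s = ∃ λ k → s ≈ vertex k

    vertex-injective : ∀ {i j} → vertex i ≈ vertex j → i ≡ j
    vertex-injective eq = place-injective (distinct V _ _ eq)

    edge-sum : ∀ {i j} → Adj C₄ i j → OnCycle (vertex i ∙ vertex j)
    edge-sum {i} {j} adjacent with Equivalence.to (proj₂ iso i j) adjacent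
    ... | _ , l , sum≈ with place-surjective l
    ...   | k , place-k≡l = k , ≈-trans sum≈ (reflexive (cong (elem V) (sym (place-k≡l refl))))

    non-edge-sum : ∀ {i j} → i ≢ j → ¬ Adj C₄ i j → ¬ OnCycle (vertex i ∙ vertex j)
    non-edge-sum {i} {j} i≢j non-adjacent (k , sum≈) =
      non-adjacent (Equivalence.from (proj₂ iso i j) (i≢j ∘ place-injective , place k , sum≈))

    0+2-off-cycle : ¬ OnCycle (vertex 0F ∙ vertex 2F)
    0+2-off-cycle = non-edge-sum (λ ()) (λ { (inj₁ ()) ; (inj₂ ()) })

    1+3-off-cycle : ¬ OnCycle (vertex 1F ∙ vertex 3F)
    1+3-off-cycle = non-edge-sum (λ ()) (λ { (inj₁ ()) ; (inj₂ ()) })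

    vertex≉ε : ∀ k → ¬ vertex k ≈ ε
    vertex≉ε 0F v≈ε = 0+2-off-cycle (2F , ≈-trans (∙-congʳ v≈ε) (identityˡ _))
    vertex≉ε 1F v≈ε = 1+3-off-cycle (3F , ≈-trans (∙-congʳ v≈ε) (identityˡ _))
    vertex≉ε 2F v≈ε = 0+2-off-cycle (0F , ≈-trans (∙-congˡ v≈ε) (identityʳ _))
    vertex≉ε 3F v≈ε = 1+3-off-cycle (1F , ≈-trans (∙-congˡ v≈ε) (identityʳ _))

    ThirdVertex : Fin 4 → Fin 4 → Set ℓ
    ThirdVertex i j = ∃ λ k → vertex i ∙ vertex j ≈ vertex k × k ≢ i × k ≢ j

    edge-third-vertex : ∀ {i j} → Adj C₄ i j → ThirdVertex i j
    edge-third-vertex {i} {j} adjacent with edge-sum adjacent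
    ... | k , sum≈ = k , sum≈
                   , (λ { refl → vertex≉ε j (∙-identity⇒ε sum≈) })
                   , (λ { refl → vertex≉ε i (∙-identity⇒ε (≈-trans (comm _ _) sum≈)) })

    cycle-order5 : ThirdVertex 0F 1F → ThirdVertex 1F 2F → ThirdVertex 2F 3F → ThirdVertex 3F 0F →
                   ∃ λ g → g OfOrder 5
    cycle-order5 (0F , _ , k≢i , _) _ _ _ = ⊥-elim (k≢i refl)
    cycle-order5 (1F , _ , _ , k≢j) _ _ _ = ⊥-elim (k≢j refl)
    cycle-order5 _ (1F , _ , k≢i , _) _ _ = ⊥-elim (k≢i refl)
    cycle-order5 _ (2F , _ , _ , k≢j) _ _ = ⊥-elim (k≢j refl)
    cycle-order5 _ _ (2F , _ , k≢i , _) _ = ⊥-elim (k≢i refl)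
    cycle-order5 _ _ (3F , _ , _ , k≢j) _ = ⊥-elim (k≢j refl)
    cycle-order5 _ _ _ (3F , _ , k≢i , _) = ⊥-elim (k≢i refl)
    cycle-order5 _ _ _ (0F , _ , _ , k≢j) = ⊥-elim (k≢j refl)
    cycle-order5 (2F , ab , _) _ _ (2F , da , _) with vertex-injective (shared-summand ab da)
    ... | ()
    cycle-order5 (3F , ab , _) (3F , bc , _) _ _ with vertex-injective (shared-summand bc ab)
    ... | ()
    cycle-order5 _ (0F , bc , _) (0F , cd , _) _ with vertex-injective (shared-summand cd bc)
    ... | ()
    cycle-order5 _ _ (1F , cd , _) (1F , da , _) with vertex-injective (shared-summand da cd)
    ... | ()
    cycle-order5 (2F , ab , _) (3F , bc , _) (0F , cd , _) (1F , da , _) =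
      vertex 1F , vertex≉ε 1F , fibonacci-cycle ab bc cd da
    cycle-order5 (3F , ab , _) (0F , bc , _) (1F , cd , _) (2F , da , _) =
      vertex 2F , vertex≉ε 2F , fibonacci-cycle (≈-trans (comm _ _) cd) (≈-trans (comm _ _) bc)
                                                (≈-trans (comm _ _) ab) (≈-trans (comm _ _) da)

  sumGraph⇒order5 : IsSumGraph A C₄ → ∃ λ g → g OfOrder 5
  sumGraph⇒order5 (m , V , iso) =
    cycle-order5 V iso (third 0F 1F refl) (third 1F 2F refl) (third 2F 3F refl) (third 3F 0F refl)
    where
    third : ∀ i j → (toℕ i + 1) % 4 ≡ toℕ j → ThirdVertex V iso i j
    third i j i→j = edge-third-vertex V iso (inj₁ i→j)

mainTheorem4 : ∀ {c ℓ : Level} (A : AbelianGroup c ℓ) (n : ℕ) →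
    HasOrder A n → (IsSumGraph A C₄ ⇔ 5 ∣ n)
mainTheorem4 A n β = mk⇔
  (λ sumGraph → order∣card β 5-prime (proj₂ (sumGraph⇒order5 sumGraph)))
  (λ 5∣n → order5⇒sumGraph (proj₂ (cauchy₅ β 5∣n)))
  where
  open ElementOrders A
  open C₄SumGraphs A
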